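{- Let $\varepsilon>0$, let $k,t$ be positive integers, and let $H$ be a graph whose vertex set is partitioned as $V(H)=A_{1}\cup A_{2}\cup B_{1}\cup\dots\cup B_{k}$ with $|A_{1}|=|A_{2}|=|B_{1}|=\dots=|B_{k}|=t$. Let $d_{ij}\ge 0$ ($i\in[2]$, $j\in[k]$) be reals. Suppose that for every $i\in[2]$, $j\in[k]$ the pair $(A_{i},B_{j})$ is $\varepsilon$-uniform and $e(A_{i},B_{j})\geq d_{ij}t^{2}$. Then $H$ contains at least \[ t\left(e(A_{1},A_{2})-2\varepsilon t^{2}\right)\left(\sum_{i=1}^{k}d_{1i}d_{2i}\right)-2\varepsilon k\,t\,e(A_{1},A_{2}) \] triangles having exactly one vertex in $A_{1}$ and exactly one vertex in $A_{2}$.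
   Context: For disjoint vertex sets $X,Y$, $e(X,Y)$ is the number of edges with one endpoint in $X$ and one in $Y$, and $d(X,Y)=e(X,Y)/(|X||Y|)$. A pair $(A,B)$ of disjoint nonempty vertex sets is $\varepsilon$-uniform if for all $X\subseteq A$, $Y\subseteq B$ with $|X|\ge\varepsilon|A|$, $|Y|\ge\varepsilon|B|$ one has $|d(X,Y)-d(A,B)|<\varepsilon$.
   Formalization: The parameter ε and the densities $d_{ij}$ range over the rationals rather than the reals. -}

module Defs where

open import Data.Bool using (Bool; true; false; _∧_; if_then_else_; T)
open import Data.Nat as ℕ using (ℕ; zero; suc)
open import Data.Fin using (Fin; _<?_)
open import Data.Fin.Properties using () renaming (_≟_ to _≟F_)
open import Data.Sum using (_⊎_; inj₁; inj₂)
open import Data.List using (List; map; foldr; allFin)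
open import Data.Nat.ListAction using (sum)
open import Data.Integer using (+_)
open import Data.Rational as Q using (ℚ; 0ℚ; _/_; ∣_∣)
open import Data.Product using (_×_)
open import Relation.Nullary.Decidable using (⌊_⌋)
open import Relation.Binary.PropositionalEquality using (_≡_)

VSet : ℕ → Set
VSet n = Fin n → Bool

record Graph (n : ℕ) : Set where
  field
    adj    : Fin n → Fin n → Bool
    sym    : ∀ u v → adj u v ≡ adj v u
    irrefl : ∀ v → adj v v ≡ false
open Graph public

_⊆_ : ∀ {n} → VSet n → VSet n → Set
X ⊆ Y = ∀ v → T (X v) → T (Y v)

indic : Bool → ℕ
indic b = if b then 1 else 0

size : ∀ {n} → VSet n → ℕ
size {n} X = sum (map (λ v → indic (X v)) (allFin n))

-- e(X,Y): number of edges with one endpoint in X and one in Y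
-- (for disjoint X, Y this is the number of pairs (x,y) ∈ X × Y with xy an edge)
eCount : ∀ {n} → Graph n → VSet n → VSet n → ℕ
eCount {n} G X Y =
  sum (map (λ x → sum (map (λ y → indic (X x ∧ Y y ∧ adj G x y)) (allFin n))) (allFin n))

ℕ→ℚ : ℕ → ℚ
ℕ→ℚ m = + m / 1

-- e / m as a rational (0 if m = 0; this case never matters below)
ratio : ℕ → ℕ → ℚ
ratio e zero = 0ℚ
ratio e (suc m) = + e / suc m

density : ∀ {n} → Graph n → VSet n → VSet n → ℚ
density G X Y = ratio (eCount G X Y) (size X ℕ.* size Y)

Uniform : ∀ {n} → Graph n → ℚ → VSet n → VSet n → Set
Uniform G ε A B =
  ∀ (X Y : VSet _) → X ⊆ A → Y ⊆ B →
  ε Q.* ℕ→ℚ (size A) Q.≤ ℕ→ℚ (size X) →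
  ε Q.* ℕ→ℚ (size B) Q.≤ ℕ→ℚ (size Y) →
  ∣ density G X Y Q.- density G A B ∣ Q.< ε

-- vertex partition labelling: inj₁ i means v ∈ A_i (i ∈ [2]), inj₂ j means v ∈ B_j (j ∈ [k])
Labelling : ℕ → ℕ → Set
Labelling n k = Fin n → Fin 2 ⊎ Fin k

isA : ∀ {n k} → Labelling n k → Fin 2 → VSet n
isA c i v with c v
... | inj₁ i' = ⌊ i' ≟F i ⌋
... | inj₂ _  = false

isB : ∀ {n k} → Labelling n k → Fin k → VSet n
isB c j v with c v
... | inj₁ _  = false
... | inj₂ j' = ⌊ j' ≟F j ⌋

sumQ : ∀ k → (Fin k → ℚ) → ℚ
sumQ k f = foldr (λ j acc → f j Q.+ acc) 0ℚ (allFin k)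

triangleCount : ∀ {n} → Graph n → VSet n → VSet n → ℕ
triangleCount {n} G S R =
  sum (map (λ x → sum (map (λ y → sum (map (λ z →
    indic (⌊ _<?_ x y ⌋ ∧ ⌊ _<?_ y z ⌋
           ∧ adj G x y ∧ adj G y z ∧ adj G x z
           ∧ ⌊ (indic (S x) ℕ.+ indic (S y) ℕ.+ indic (S z)) ℕ.≟ 1 ⌋
           ∧ ⌊ (indic (R x) ℕ.+ indic (R y) ℕ.+ indic (R z)) ℕ.≟ 1 ⌋))
    (allFin n))) (allFin n))) (allFin n))

{-# OPTIONS --safe #-}

-- Fix one part B = Bⱼ and write t for the common size of the parts. By uniformity of (A₁, B), at most εt
-- vertices of A₁ have fewer than (d₁ - ε)t neighbours in B. If x ∈ A₁ has at least εt neighbours in B,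
-- this neighbourhood is large enough for the uniformity of (A₂, B), so at most εt vertices y ∈ A₂ have
-- fewer than (d₂ - ε) |N_B(x)| neighbours in it. Hence all but 2εt² of the edges xy between A₁ and A₂
-- have at least t d₁ d₂ - 2εt common neighbours in B (if x has fewer than εt neighbours in B this bound
-- is not positive). Summing over the parts Bⱼ counts each triangle with one vertex in A₁, one in A₂ and
-- one in some Bⱼ exactly once, and in triangleCount such a triangle appears once, for the one ordering
-- of its vertices that is increasing.

module Submission where

open import Defs hiding (sym)
open import Data.Nat using (ℕ; NonZero)
open import Data.Fin using (Fin; zero; suc)
open import Relation.Binary.PropositionalEquality using (_≡_)

open import Algebra.Bundles using (CommutativeRing)
import Algebra.Properties.Semiring.Sum as SemiringSum
open import Data.Bool using (Bool; true; false; T; not; _∧_; _∨_)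
open import Data.Bool.Properties using (∧-assoc; ∧-comm; T-∧; T-∨)
open import Data.Empty using (⊥; ⊥-elim)
open import Data.Fin.Patterns using (0F; 1F; 2F; 3F; 4F; 5F)
import Data.Integer as ℤ
import Data.Integer.Properties as ℤ
open import Data.List using (map; tabulate; allFin)
import Data.List as List using (foldr)
open import Data.List.Properties using (map-tabulate)
import Data.Nat as ℕ
open import Data.Nat.Coprimality using (1-coprimeTo) renaming (sym to coprime-sym)
import Data.Nat.ListAction as ListAction
import Data.Nat.Properties as ℕ
open import Data.Product using (_×_; _,_; proj₁; proj₂; ∃-syntax)
import Data.Rational as ℚ
import Data.Rational.Properties as ℚ
import Data.Rational.Unnormalised as ℚᵘ
import Data.Rational.Unnormalised.Properties as ℚᵘ
open import Data.Sum using (_⊎_; inj₁; inj₂; [_,_]′)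
open import Data.Unit using (tt)
import Data.Vec.Functional as Vector
open import Function using (_∘_; id; Equivalence)
open import Level using (0ℓ)
open import Relation.Binary.Definitions using (tri<; tri≈; tri>)
open import Relation.Binary.PropositionalEquality
  using (_≢_; refl; sym; trans; cong; cong₂; subst; subst₂; module ≡-Reasoning)
open import Relation.Nullary.Decidable using (⌊_⌋; ⌊⌋-map′; fromWitness; toWitness; dec⇒maybe)
import Tactic.RingSolver.Core.AlmostCommutativeRing as ACR
open import Tactic.RingSolver using (solve-∀)

foldr-tabulate : ∀ {A B : Set} (_∙_ : B → B → B) (e : B) (f : A → B) {n} (g : Fin n → A) →
                 List.foldr (λ a acc → f a ∙ acc) e (tabulate g) ≡ Vector.foldr _∙_ e (f ∘ g)
foldr-tabulate _∙_ e f {ℕ.zero}  g = refl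
foldr-tabulate _∙_ e f {ℕ.suc n} g = cong (f (g zero) ∙_) (foldr-tabulate _∙_ e f (g ∘ suc))

module Counting where

  open import Data.Fin using (_<?_) renaming (_<_ to _<F_)
  open import Data.Fin.Properties using (<-cmp) renaming (_≟_ to _≟F_)
  open import Data.Nat using (_+_; _*_; _≤_; z≤n; s≤s; _≟_; >-nonZero)
  open import Data.Nat.Properties
    using (+-*-semiring; +-identityʳ; *-zeroʳ; *-comm; +-mono-≤; *-monoˡ-≤; *-monoʳ-≤;
           ≤-trans; ≤-reflexive; m≤m+n; m≤n+m; m≤m*n; ≤ᵇ⇒≤; module ≤-Reasoning)
  open SemiringSum +-*-semiring
    using (sum; sum-syntax; sum-cong-≗; sum-replicate-zero; ∑-comm; ∑-distrib-+; *-distribˡ-sum; *-distribʳ-sum)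

  T-not-elim : ∀ {b} → T b → T (not b) → ⊥
  T-not-elim {true} _ ()

  ∧-reverse : ∀ p q r → p ∧ q ∧ r ≡ r ∧ q ∧ p
  ∧-reverse p q r = begin
    p ∧ q ∧ r     ≡⟨ ∧-comm p (q ∧ r) ⟩
    (q ∧ r) ∧ p   ≡⟨ cong (_∧ p) (∧-comm q r) ⟩
    (r ∧ q) ∧ p   ≡⟨ ∧-assoc r q p ⟩
    r ∧ q ∧ p     ∎
    where open ≡-Reasoning

  indic-∧ : ∀ p q → indic (p ∧ q) ≡ indic p * indic q
  indic-∧ true  q = sym (+-identityʳ (indic q))
  indic-∧ false q = refl

  indic-T : ∀ {p} → T p → indic p ≡ 1
  indic-T {true} _ = refl

  indic-mono : ∀ {p q} → (T p → T q) → indic p ≤ indic q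
  indic-mono {false} _   = z≤n
  indic-mono {true}  p⇒q = ≤-reflexive (sym (indic-T (p⇒q tt)))

  indic-∧-assoc : ∀ p q r → indic (p ∧ q ∧ r) ≡ indic (p ∧ q) * indic r
  indic-∧-assoc p q r = trans (cong indic (sym (∧-assoc p q r))) (indic-∧ (p ∧ q) r)

  *-indic-≤ : ∀ m p {k} → (T p → 1 ≤ k) → m * indic p ≤ m * indic p * k
  *-indic-≤ m false _   rewrite *-zeroʳ m = z≤n
  *-indic-≤ m true  1≤k = m≤m*n (m * 1) _ {{>-nonZero (1≤k tt)}}

  sum-allFin : ∀ {n} (f : Fin n → ℕ) → ListAction.sum (map f (allFin n)) ≡ sum f
  sum-allFin f = trans (cong ListAction.sum (map-tabulate id f)) (foldr-tabulate _+_ 0 id f)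

  ∑-mono-≤ : ∀ {n} {f g : Fin n → ℕ} → (∀ i → f i ≤ g i) → sum f ≤ sum g
  ∑-mono-≤ {ℕ.zero}  f≤g = z≤n
  ∑-mono-≤ {ℕ.suc n} f≤g = +-mono-≤ (f≤g zero) (∑-mono-≤ (f≤g ∘ suc))

  term≤∑ : ∀ {n} (f : Fin n → ℕ) i → f i ≤ sum f
  term≤∑ f zero    = m≤m+n (f zero) _
  term≤∑ f (suc i) = ≤-trans (term≤∑ (f ∘ suc) i) (m≤n+m _ (f zero))

  ∑-delta : ∀ {k} (i : Fin k) → ∑[ j < k ] indic ⌊ i ≟F j ⌋ ≡ 1
  ∑-delta {ℕ.suc k} zero    = cong ℕ.suc (sum-replicate-zero k)
  ∑-delta {ℕ.suc k} (suc i) = trans (sum-cong-≗ (λ j → cong indic (⌊⌋-map′ _ _ (i ≟F j)))) (∑-delta i)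

  ∑∑-indic-mono : ∀ {n} {p q : Fin n → Fin n → Bool} (w : Fin n → Fin n → ℕ) → (∀ x y → T (p x y) → T (q x y)) →
                  ∑[ x < n ] ∑[ y < n ] (indic (p x y) * w x y) ≤ ∑[ x < n ] ∑[ y < n ] (indic (q x y) * w x y)
  ∑∑-indic-mono w p⇒q = ∑-mono-≤ (λ x → ∑-mono-≤ (λ y → *-monoˡ-≤ (w x y) (indic-mono (p⇒q x y))))

  size-∑ : ∀ {n} (X : VSet n) → size X ≡ ∑[ v < n ] indic (X v)
  size-∑ X = sum-allFin (λ v → indic (X v))

  size-mono : ∀ {n} {X Y : VSet n} → X ⊆ Y → size X ≤ size Y
  size-mono {X = X} {Y} X⊆Y rewrite size-∑ X | size-∑ Y = ∑-mono-≤ (λ v → indic-mono (X⊆Y v))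

  module _ {A B : Set} where

    rearrange : Fin 6 → A × A × A → A × A × A
    rearrange 0F (x , y , z) = x , y , z
    rearrange 1F (x , y , z) = x , z , y
    rearrange 2F (x , y , z) = y , x , z
    rearrange 3F (x , y , z) = y , z , x
    rearrange 4F (x , y , z) = z , x , y
    rearrange 5F (x , y , z) = z , y , x

    -- Projections rather than pattern matching, so that permute s commutes definitionally with
    -- pointwise operations also for a variable s.
    uncurry₃ : (A → A → A → B) → A × A × A → B
    uncurry₃ f t = f (proj₁ t) (proj₁ (proj₂ t)) (proj₂ (proj₂ t))

    permute : Fin 6 → (A → A → A → B) → A → A → A → B
    permute s f x y z = uncurry₃ f (rearrange s (x , y , z))

  inverse : Fin 6 → Fin 6
  inverse 3F = 4F
  inverse 4F = 3F
  inverse s  = s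

  module _ {n : ℕ} where

    ∑³ : (Fin n → Fin n → Fin n → ℕ) → ℕ
    ∑³ f = ∑[ x < n ] ∑[ y < n ] ∑[ z < n ] f x y z

    ∑³-mono-≤ : ∀ {f g} → (∀ x y z → f x y z ≤ g x y z) → ∑³ f ≤ ∑³ g
    ∑³-mono-≤ f≤g = ∑-mono-≤ (λ x → ∑-mono-≤ (λ y → ∑-mono-≤ (f≤g x y)))

    ∑³-cong : ∀ {f g} → (∀ x y z → f x y z ≡ g x y z) → ∑³ f ≡ ∑³ g
    ∑³-cong f≡g = sum-cong-≗ (λ x → sum-cong-≗ (λ y → sum-cong-≗ (f≡g x y)))

    ∑³-swap₁₂ : ∀ f → ∑³ (λ x y z → f y x z) ≡ ∑³ f
    ∑³-swap₁₂ f = ∑-comm (λ x y → ∑[ z < n ] f y x z)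

    ∑³-swap₂₃ : ∀ f → ∑³ (λ x y z → f x z y) ≡ ∑³ f
    ∑³-swap₂₃ f = sum-cong-≗ (λ x → ∑-comm (λ y z → f x z y))

    ∑³-permute : ∀ s f → ∑³ (permute s f) ≡ ∑³ f
    ∑³-permute 0F f = refl
    ∑³-permute 1F f = ∑³-swap₂₃ f
    ∑³-permute 2F f = ∑³-swap₁₂ f
    ∑³-permute 3F f = trans (∑³-swap₁₂ (λ x y z → f x z y)) (∑³-swap₂₃ f)
    ∑³-permute 4F f = trans (∑³-swap₂₃ (λ x y z → f y x z)) (∑³-swap₁₂ f)
    ∑³-permute 5F f = trans (∑³-swap₁₂ (λ x y z → f z x y)) (∑³-permute 4F f)

    ∑³-reorder : ∀ s f g → ∑³ (λ x y z → f x y z * permute s g x y z)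
                         ≡ ∑³ (λ x y z → permute (inverse s) f x y z * g x y z)
    ∑³-reorder 0F f g = refl
    ∑³-reorder 1F f g = sym (∑³-permute 1F (λ x y z → f x y z * permute 1F g x y z))
    ∑³-reorder 2F f g = sym (∑³-permute 2F (λ x y z → f x y z * permute 2F g x y z))
    ∑³-reorder 3F f g = sym (∑³-permute 4F (λ x y z → f x y z * permute 3F g x y z))
    ∑³-reorder 4F f g = sym (∑³-permute 3F (λ x y z → f x y z * permute 4F g x y z))
    ∑³-reorder 5F f g = sym (∑³-permute 5F (λ x y z → f x y z * permute 5F g x y z))

    ∑³-∑ : ∀ {k} (f : Fin k → Fin n → Fin n → Fin n → ℕ) →
           ∑³ (λ x y z → ∑[ s < k ] f s x y z) ≡ ∑[ s < k ] ∑³ (f s)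
    ∑³-∑ {k} f = begin
      ∑[ x < n ] ∑[ y < n ] ∑[ z < n ] ∑[ s < k ] f s x y z
        ≡⟨ sum-cong-≗ (λ x → sum-cong-≗ (λ y → ∑-comm (λ s z → f s x y z))) ⟨
      ∑[ x < n ] ∑[ y < n ] ∑[ s < k ] ∑[ z < n ] f s x y z
        ≡⟨ sum-cong-≗ (λ x → ∑-comm (λ s y → ∑[ z < n ] f s x y z)) ⟨
      ∑[ x < n ] ∑[ s < k ] ∑[ y < n ] ∑[ z < n ] f s x y z
        ≡⟨ ∑-comm (λ s x → ∑[ y < n ] ∑[ z < n ] f s x y z) ⟨
      ∑[ s < k ] ∑³ (f s) ∎
      where open ≡-Reasoning

  data Part : Bool → Bool → Bool → Set where
    in-A₁ : Part true false false
    in-A₂ : Part false true false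
    in-B  : Part false false true

  rainbow : ∀ {V : Set} → (V → Bool) → (V → Bool) → (V → Bool) → V → V → V → Bool
  rainbow A₁ A₂ B x y z = A₁ x ∧ A₂ y ∧ B z

  exactlyOne : Bool → Bool → Bool → Bool
  exactlyOne p q r = ⌊ indic p + indic q + indic r ≟ 1 ⌋

  rainbow-orderings : ∀ {V : Set} {A₁ A₂ B : V → Bool} → (∀ v → Part (A₁ v) (A₂ v) (B v)) → ∀ a b c →
                      ∑[ s < 6 ] indic (permute (inverse s) (rainbow A₁ A₂ B) a b c)
                        ≤ indic (exactlyOne (A₁ a) (A₁ b) (A₁ c) ∧ exactlyOne (A₂ a) (A₂ b) (A₂ c))
  rainbow-orderings part a b c = on-parts (part a) (part b) (part c)
    where
    -- The same claim for the generic triple 0F 1F 2F, so that matching on the parts evaluates both sides.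
    on-parts : ∀ {a₁ a₂ a₃ b₁ b₂ b₃ c₁ c₂ c₃} → Part a₁ a₂ a₃ → Part b₁ b₂ b₃ → Part c₁ c₂ c₃ →
               ∑[ s < 6 ] indic (permute (inverse s)
                 (rainbow (a₁ Vector.∷ b₁ Vector.∷ c₁ Vector.∷ Vector.[])
                          (a₂ Vector.∷ b₂ Vector.∷ c₂ Vector.∷ Vector.[])
                          (a₃ Vector.∷ b₃ Vector.∷ c₃ Vector.∷ Vector.[])) 0F 1F 2F)
                 ≤ indic (exactlyOne a₁ b₁ c₁ ∧ exactlyOne a₂ b₂ c₂)
    on-parts in-A₁ in-A₁ in-A₁ = ≤ᵇ⇒≤ _ _ tt
    on-parts in-A₁ in-A₁ in-A₂ = ≤ᵇ⇒≤ _ _ tt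
    on-parts in-A₁ in-A₁ in-B  = ≤ᵇ⇒≤ _ _ tt
    on-parts in-A₁ in-A₂ in-A₁ = ≤ᵇ⇒≤ _ _ tt
    on-parts in-A₁ in-A₂ in-A₂ = ≤ᵇ⇒≤ _ _ tt
    on-parts in-A₁ in-A₂ in-B  = ≤ᵇ⇒≤ _ _ tt
    on-parts in-A₁ in-B  in-A₁ = ≤ᵇ⇒≤ _ _ tt
    on-parts in-A₁ in-B  in-A₂ = ≤ᵇ⇒≤ _ _ tt
    on-parts in-A₁ in-B  in-B  = ≤ᵇ⇒≤ _ _ tt
    on-parts in-A₂ in-A₁ in-A₁ = ≤ᵇ⇒≤ _ _ tt
    on-parts in-A₂ in-A₁ in-A₂ = ≤ᵇ⇒≤ _ _ tt
    on-parts in-A₂ in-A₁ in-B  = ≤ᵇ⇒≤ _ _ tt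
    on-parts in-A₂ in-A₂ in-A₁ = ≤ᵇ⇒≤ _ _ tt
    on-parts in-A₂ in-A₂ in-A₂ = ≤ᵇ⇒≤ _ _ tt
    on-parts in-A₂ in-A₂ in-B  = ≤ᵇ⇒≤ _ _ tt
    on-parts in-A₂ in-B  in-A₁ = ≤ᵇ⇒≤ _ _ tt
    on-parts in-A₂ in-B  in-A₂ = ≤ᵇ⇒≤ _ _ tt
    on-parts in-A₂ in-B  in-B  = ≤ᵇ⇒≤ _ _ tt
    on-parts in-B  in-A₁ in-A₁ = ≤ᵇ⇒≤ _ _ tt
    on-parts in-B  in-A₁ in-A₂ = ≤ᵇ⇒≤ _ _ tt
    on-parts in-B  in-A₁ in-B  = ≤ᵇ⇒≤ _ _ tt
    on-parts in-B  in-A₂ in-A₁ = ≤ᵇ⇒≤ _ _ tt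
    on-parts in-B  in-A₂ in-A₂ = ≤ᵇ⇒≤ _ _ tt
    on-parts in-B  in-A₂ in-B  = ≤ᵇ⇒≤ _ _ tt
    on-parts in-B  in-B  in-A₁ = ≤ᵇ⇒≤ _ _ tt
    on-parts in-B  in-B  in-A₂ = ≤ᵇ⇒≤ _ _ tt
    on-parts in-B  in-B  in-B  = ≤ᵇ⇒≤ _ _ tt

  module _ {n} (H : Graph n) where

    N : VSet n → Fin n → VSet n
    N Y x z = Y z ∧ adj H x z

    deg : VSet n → Fin n → ℕ
    deg Y x = size (N Y x)

    codegree : VSet n → Fin n → Fin n → ℕ
    codegree B x y = deg (N B x) y

    trianglesAcross : VSet n → VSet n → VSet n → ℕ
    trianglesAcross A₁ A₂ B = ∑[ x < n ] ∑[ y < n ] (indic (A₁ x ∧ A₂ y ∧ adj H x y) * codegree B x y)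

    deg≤size : ∀ Y x → deg Y x ≤ size Y
    deg≤size Y x = size-mono {X = N Y x} {Y} (λ v → proj₁ ∘ Equivalence.to T-∧)

    eCount-∑ : ∀ X Y → eCount H X Y ≡ ∑[ x < n ] ∑[ y < n ] indic (X x ∧ Y y ∧ adj H x y)
    eCount-∑ X Y = trans (sum-allFin (λ x → ListAction.sum (map (edge x) (allFin n))))
                         (sum-cong-≗ (λ x → sum-allFin (edge x)))
      where
      edge : Fin n → Fin n → ℕ
      edge x y = indic (X x ∧ Y y ∧ adj H x y)

    eCount-deg : ∀ X Y → eCount H X Y ≡ ∑[ x < n ] (indic (X x) * deg Y x)
    eCount-deg X Y = trans (eCount-∑ X Y) (sum-cong-≗ row)
      where
      open ≡-Reasoning
      row : ∀ x → ∑[ y < n ] indic (X x ∧ N Y x y) ≡ indic (X x) * deg Y x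
      row x = begin
        ∑[ y < n ] indic (X x ∧ N Y x y)        ≡⟨ sum-cong-≗ (λ y → indic-∧ (X x) (N Y x y)) ⟩
        ∑[ y < n ] (indic (X x) * indic (N Y x y)) ≡⟨ *-distribˡ-sum (indic (X x)) (λ y → indic (N Y x y)) ⟨
        indic (X x) * ∑[ y < n ] indic (N Y x y) ≡⟨ cong (indic (X x) *_) (size-∑ (N Y x)) ⟨
        indic (X x) * deg Y x                    ∎

    eCount≤size*size : ∀ X Y → eCount H X Y ≤ size X * size Y
    eCount≤size*size X Y = begin
      eCount H X Y                          ≡⟨ eCount-deg X Y ⟩
      ∑[ x < n ] (indic (X x) * deg Y x)    ≤⟨ ∑-mono-≤ (λ x → *-monoʳ-≤ (indic (X x)) (deg≤size Y x)) ⟩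
      ∑[ x < n ] (indic (X x) * size Y)     ≡⟨ *-distribʳ-sum (size Y) (λ x → indic (X x)) ⟨
      (∑[ x < n ] indic (X x)) * size Y     ≡⟨ cong (_* size Y) (size-∑ X) ⟨
      size X * size Y                       ∎
      where open ≤-Reasoning

    codegree-∑ : ∀ B x y → codegree B x y ≡ ∑[ z < n ] (indic (B z) * indic (adj H x z ∧ adj H y z))
    codegree-∑ B x y = trans (size-∑ (N (N B x) y))
      (sum-cong-≗ (λ z → trans (cong indic (∧-assoc (B z) (adj H x z) (adj H y z))) (indic-∧ (B z) _)))

    ∑-codegree : ∀ {k} (B : Fin k → VSet n) O → (∀ z → ∑[ j < k ] indic (B j z) ≡ indic (O z)) →
                 ∀ x y → ∑[ j < k ] codegree (B j) x y ≡ codegree O x y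
    ∑-codegree {k} B O partition x y = begin
      ∑[ j < k ] codegree (B j) x y
        ≡⟨ sum-cong-≗ (λ j → codegree-∑ (B j) x y) ⟩
      ∑[ j < k ] ∑[ z < n ] (indic (B j z) * common z)
        ≡⟨ ∑-comm (λ j z → indic (B j z) * common z) ⟩
      ∑[ z < n ] ∑[ j < k ] (indic (B j z) * common z)
        ≡⟨ sum-cong-≗ (λ z → *-distribʳ-sum (common z) (λ j → indic (B j z))) ⟨
      ∑[ z < n ] ((∑[ j < k ] indic (B j z)) * common z)
        ≡⟨ sum-cong-≗ (λ z → cong (_* common z) (partition z)) ⟩
      ∑[ z < n ] (indic (O z) * common z)
        ≡⟨ codegree-∑ O x y ⟨
      codegree O x y ∎
      where
      open ≡-Reasoning
      common : Fin n → ℕ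
      common z = indic (adj H x z ∧ adj H y z)

    ∑-trianglesAcross : ∀ {k} A₁ A₂ (B : Fin k → VSet n) O → (∀ z → ∑[ j < k ] indic (B j z) ≡ indic (O z)) →
                        ∑[ j < k ] trianglesAcross A₁ A₂ (B j) ≡ trianglesAcross A₁ A₂ O
    ∑-trianglesAcross {k} A₁ A₂ B O partition = begin
      ∑[ j < k ] ∑[ x < n ] ∑[ y < n ] (edge x y * codegree (B j) x y)
        ≡⟨ ∑-comm (λ j x → ∑[ y < n ] (edge x y * codegree (B j) x y)) ⟩
      ∑[ x < n ] ∑[ j < k ] ∑[ y < n ] (edge x y * codegree (B j) x y)
        ≡⟨ sum-cong-≗ (λ x → ∑-comm (λ j y → edge x y * codegree (B j) x y)) ⟩
      ∑[ x < n ] ∑[ y < n ] ∑[ j < k ] (edge x y * codegree (B j) x y)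
        ≡⟨ sum-cong-≗ (λ x → sum-cong-≗ (λ y → *-distribˡ-sum (edge x y) (λ j → codegree (B j) x y))) ⟨
      ∑[ x < n ] ∑[ y < n ] (edge x y * ∑[ j < k ] codegree (B j) x y)
        ≡⟨ sum-cong-≗ (λ x → sum-cong-≗ (λ y → cong (edge x y *_) (∑-codegree B O partition x y))) ⟩
      ∑[ x < n ] ∑[ y < n ] (edge x y * codegree O x y) ∎
      where
      open ≡-Reasoning
      edge : Fin n → Fin n → ℕ
      edge x y = indic (A₁ x ∧ A₂ y ∧ adj H x y)

    triangle : Fin n → Fin n → Fin n → Bool
    triangle x y z = adj H x y ∧ adj H y z ∧ adj H x z

    ordered : Fin n → Fin n → Fin n → Bool
    ordered x y z = ⌊ x <? y ⌋ ∧ ⌊ y <? z ⌋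

    triangle-swap₁₂ : ∀ x y z → triangle y x z ≡ triangle x y z
    triangle-swap₁₂ x y z rewrite Graph.sym H y x = cong (adj H x y ∧_) (∧-comm (adj H x z) (adj H y z))

    triangle-swap₂₃ : ∀ x y z → triangle x z y ≡ triangle x y z
    triangle-swap₂₃ x y z rewrite Graph.sym H z y = ∧-reverse (adj H x z) (adj H y z) (adj H x y)

    triangle-permute : ∀ s x y z → permute s triangle x y z ≡ triangle x y z
    triangle-permute 0F x y z = refl
    triangle-permute 1F x y z = triangle-swap₂₃ x y z
    triangle-permute 2F x y z = triangle-swap₁₂ x y z
    triangle-permute 3F x y z = trans (triangle-swap₂₃ y x z) (triangle-swap₁₂ x y z)
    triangle-permute 4F x y z = trans (triangle-swap₁₂ x z y) (triangle-swap₂₃ x y z)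
    triangle-permute 5F x y z = trans (triangle-swap₁₂ y z x) (triangle-permute 3F x y z)

    adj⇒≢ : ∀ {x y} → T (adj H x y) → x ≢ y
    adj⇒≢ {x} xy refl = subst T (Graph.irrefl H x) xy

    ordered-intro : ∀ {x y z} → x <F y → y <F z → T (ordered x y z)
    ordered-intro {x} {y} {z} x<y y<z =
      Equivalence.from (T-∧ {⌊ x <? y ⌋}) (fromWitness {a? = x <? y} x<y , fromWitness {a? = y <? z} y<z)

    some-ordering : ∀ {x y z} → x ≢ y → y ≢ z → x ≢ z → ∃[ s ] T (permute s ordered x y z)
    some-ordering {x} {y} {z} x≢y y≢z x≢z with <-cmp x y | <-cmp y z | <-cmp x z
    ... | tri≈ _ x≡y _ | _              | _              = ⊥-elim (x≢y x≡y)
    ... | _            | tri≈ _ y≡z _   | _              = ⊥-elim (y≢z y≡z)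
    ... | _            | _              | tri≈ _ x≡z _   = ⊥-elim (x≢z x≡z)
    ... | tri< x<y _ _ | tri< y<z _ _   | _              = 0F , ordered-intro x<y y<z
    ... | tri< x<y _ _ | tri> _ _ z<y   | tri< x<z _ _   = 1F , ordered-intro x<z z<y
    ... | tri> _ _ y<x | tri< y<z _ _   | tri< x<z _ _   = 2F , ordered-intro y<x x<z
    ... | tri> _ _ y<x | tri< y<z _ _   | tri> _ _ z<x   = 3F , ordered-intro y<z z<x
    ... | tri< x<y _ _ | tri> _ _ z<y   | tri> _ _ z<x   = 4F , ordered-intro z<x x<y
    ... | tri> _ _ y<x | tri> _ _ z<y   | _              = 5F , ordered-intro z<y y<x

    triangle⇒ordering : ∀ {x y z} → T (triangle x y z) → 1 ≤ ∑[ s < 6 ] indic (permute s ordered x y z)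
    triangle⇒ordering {x} {y} {z} xyz with Equivalence.to T-∧ xyz
    ... | xy , yz,xz with Equivalence.to T-∧ yz,xz
    ... | yz , xz with some-ordering (adj⇒≢ xy) (adj⇒≢ yz) (adj⇒≢ xz)
    ... | s , sorted = ≤-trans (≤-reflexive (sym (indic-T sorted))) (term≤∑ (λ s → indic (permute s ordered x y z)) s)

    trianglesAcross-∑³ : ∀ A₁ A₂ B →
      trianglesAcross A₁ A₂ B ≡ ∑³ (λ x y z → indic (rainbow A₁ A₂ B x y z) * indic (triangle x y z))
    trianglesAcross-∑³ A₁ A₂ B = sum-cong-≗ λ x → sum-cong-≗ λ y → begin
      edge x y * codegree B x y
        ≡⟨ cong (edge x y *_) (codegree-∑ B x y) ⟩
      edge x y * ∑[ z < n ] (indic (B z) * common x y z)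
        ≡⟨ *-distribˡ-sum (edge x y) (λ z → indic (B z) * common x y z) ⟩
      ∑[ z < n ] (edge x y * (indic (B z) * common x y z))
        ≡⟨ sum-cong-≗ (λ z → regroup (A₁ x) (A₂ y) (adj H x y) (B z) (adj H x z) (adj H y z)) ⟩
      ∑[ z < n ] (indic (rainbow A₁ A₂ B x y z) * indic (triangle x y z)) ∎
      where
      open ≡-Reasoning
      edge : Fin n → Fin n → ℕ
      edge x y = indic (A₁ x ∧ A₂ y ∧ adj H x y)
      common : Fin n → Fin n → Fin n → ℕ
      common x y z = indic (adj H x z ∧ adj H y z)
      regroup : ∀ a₁ a₂ e₁ b e₂ e₃ →
                indic (a₁ ∧ a₂ ∧ e₁) * (indic b * indic (e₂ ∧ e₃)) ≡ indic (a₁ ∧ a₂ ∧ b) * indic (e₁ ∧ e₃ ∧ e₂)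
      regroup false _    _     _     _     _     = refl
      regroup true  false _     _     _     _     = refl
      regroup true  true  false false _     _     = refl
      regroup true  true  false true  _     _     = refl
      regroup true  true  true  false _     _     = refl
      regroup true  true  true  true  false false = refl
      regroup true  true  true  true  false true  = refl
      regroup true  true  true  true  true  false = refl
      regroup true  true  true  true  true  true  = refl

    oneEach : VSet n → VSet n → Fin n → Fin n → Fin n → Bool
    oneEach S R a b c = exactlyOne (S a) (S b) (S c) ∧ exactlyOne (R a) (R b) (R c)

    triangleCount-∑³ : ∀ S R →
      triangleCount H S R ≡ ∑³ (λ a b c → indic (ordered a b c) * (indic (triangle a b c) * indic (oneEach S R a b c)))
    triangleCount-∑³ S R =
      trans (sum-allFin (λ a → ListAction.sum (map (λ b → ListAction.sum (map (counted a b) (allFin n))) (allFin n))))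
      (sum-cong-≗ λ a → trans (sum-allFin (λ b → ListAction.sum (map (counted a b) (allFin n))))
      (sum-cong-≗ λ b → trans (sum-allFin (counted a b))
      (sum-cong-≗ λ c → split ⌊ a <? b ⌋ ⌊ b <? c ⌋ (adj H a b) (adj H b c) (adj H a c) (oneEach S R a b c))))
      where
      counted : Fin n → Fin n → Fin n → ℕ
      counted a b c = indic (⌊ a <? b ⌋ ∧ ⌊ b <? c ⌋ ∧ adj H a b ∧ adj H b c ∧ adj H a c ∧ oneEach S R a b c)
      split : ∀ o₁ o₂ e₁ e₂ e₃ x →
              indic (o₁ ∧ o₂ ∧ e₁ ∧ e₂ ∧ e₃ ∧ x) ≡ indic (o₁ ∧ o₂) * (indic (e₁ ∧ e₂ ∧ e₃) * indic x)
      split o₁ o₂ e₁ e₂ e₃ x = trans (indic-∧-assoc o₁ o₂ _) (cong (indic (o₁ ∧ o₂) *_)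
        (trans (cong (λ e → indic (e₁ ∧ e)) (sym (∧-assoc e₂ e₃ x))) (indic-∧-assoc e₁ (e₂ ∧ e₃) x)))

    module _ {A₁ A₂ B : VSet n} (part : ∀ v → Part (A₁ v) (A₂ v) (B v)) where

      rainbowTriangle : Fin n → Fin n → Fin n → ℕ
      rainbowTriangle x y z = indic (rainbow A₁ A₂ B x y z) * indic (triangle x y z)

      ordered-rainbowTriangles : ∀ a b c →
        (∑[ s < 6 ] permute (inverse s) rainbowTriangle a b c) * indic (ordered a b c)
          ≤ indic (ordered a b c) * (indic (triangle a b c) * indic (oneEach A₁ A₂ a b c))
      ordered-rainbowTriangles a b c = begin
        (∑[ s < 6 ] permute (inverse s) rainbowTriangle a b c) * o
          ≡⟨ cong (_* o) (sum-cong-≗ (λ s → cong (λ t → indic (permute (inverse s) (rainbow A₁ A₂ B) a b c) * indic t)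
                                                  (triangle-permute (inverse s) a b c))) ⟩
        (∑[ s < 6 ] (indic (permute (inverse s) (rainbow A₁ A₂ B) a b c) * t)) * o
          ≡⟨ cong (_* o) (*-distribʳ-sum t (λ s → indic (permute (inverse s) (rainbow A₁ A₂ B) a b c))) ⟨
        (∑[ s < 6 ] indic (permute (inverse s) (rainbow A₁ A₂ B) a b c)) * t * o
          ≤⟨ *-monoˡ-≤ o (*-monoˡ-≤ t (rainbow-orderings part a b c)) ⟩
        indic (oneEach A₁ A₂ a b c) * t * o
          ≡⟨ *-comm (indic (oneEach A₁ A₂ a b c) * t) o ⟩
        o * (indic (oneEach A₁ A₂ a b c) * t)
          ≡⟨ cong (o *_) (*-comm (indic (oneEach A₁ A₂ a b c)) t) ⟩
        o * (t * indic (oneEach A₁ A₂ a b c)) ∎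
        where
        open ≤-Reasoning
        o t : ℕ
        o = indic (ordered a b c)
        t = indic (triangle a b c)

      trianglesAcross≤triangleCount : trianglesAcross A₁ A₂ B ≤ triangleCount H A₁ A₂
      trianglesAcross≤triangleCount = begin
        trianglesAcross A₁ A₂ B
          ≡⟨ trianglesAcross-∑³ A₁ A₂ B ⟩
        ∑³ rainbowTriangle
          ≤⟨ ∑³-mono-≤ (λ x y z → *-indic-≤ (indic (rainbow A₁ A₂ B x y z)) (triangle x y z) triangle⇒ordering) ⟩
        ∑³ (λ x y z → rainbowTriangle x y z * ∑[ s < 6 ] indic (permute s ordered x y z))
          ≡⟨ ∑³-cong (λ x y z → *-distribˡ-sum (rainbowTriangle x y z) (λ s → indic (permute s ordered x y z))) ⟩
        ∑³ (λ x y z → ∑[ s < 6 ] (rainbowTriangle x y z * indic (permute s ordered x y z)))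
          ≡⟨ ∑³-∑ (λ s x y z → rainbowTriangle x y z * indic (permute s ordered x y z)) ⟩
        ∑[ s < 6 ] ∑³ (λ x y z → rainbowTriangle x y z * indic (permute s ordered x y z))
          ≡⟨ sum-cong-≗ (λ s → ∑³-reorder s rainbowTriangle (λ x y z → indic (ordered x y z))) ⟩
        ∑[ s < 6 ] ∑³ (λ x y z → permute (inverse s) rainbowTriangle x y z * indic (ordered x y z))
          ≡⟨ ∑³-∑ (λ s x y z → permute (inverse s) rainbowTriangle x y z * indic (ordered x y z)) ⟨
        ∑³ (λ x y z → ∑[ s < 6 ] (permute (inverse s) rainbowTriangle x y z * indic (ordered x y z)))
          ≡⟨ ∑³-cong (λ x y z → *-distribʳ-sum (indic (ordered x y z))
                                               (λ s → permute (inverse s) rainbowTriangle x y z)) ⟨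
        ∑³ (λ x y z → (∑[ s < 6 ] permute (inverse s) rainbowTriangle x y z) * indic (ordered x y z))
          ≤⟨ ∑³-mono-≤ ordered-rainbowTriangles ⟩
        ∑³ (λ a b c → indic (ordered a b c) * (indic (triangle a b c) * indic (oneEach A₁ A₂ a b c)))
          ≡⟨ triangleCount-∑³ A₁ A₂ ⟨
        triangleCount H A₁ A₂ ∎
        where open ≤-Reasoning

  edge-cover : ∀ a₁ a₂ e l₁ b l₂ →
    indic (a₁ ∧ a₂ ∧ e) ≤ indic ((a₁ ∧ a₂ ∧ e) ∧ not l₁ ∧ (not b ∨ not l₂)) + (indic l₁ * indic a₂ + indic b * indic l₂)
  edge-cover false _     _     _     _     _     = z≤n
  edge-cover true  false _     _     _     _     = z≤n
  edge-cover true  true  false _     _     _     = z≤n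
  edge-cover true  true  true  true  _     _     = s≤s z≤n
  edge-cover true  true  true  false false _     = s≤s z≤n
  edge-cover true  true  true  false true  false = s≤s z≤n
  edge-cover true  true  true  false true  true  = s≤s z≤n

  goodPair : ∀ {n} (Bad₁ Big : VSet n) (Bad₂ : Fin n → VSet n) → Fin n → Fin n → Bool
  goodPair Bad₁ Big Bad₂ x y = not (Bad₁ x) ∧ (not (Big x) ∨ not (Bad₂ x y))

  badPairs : ∀ {n} (A₂ Bad₁ Big : VSet n) (Bad₂ : Fin n → VSet n) → ℕ
  badPairs {n} A₂ Bad₁ Big Bad₂ = size Bad₁ * size A₂ + ∑[ x < n ] (indic (Big x) * size (Bad₂ x))

  module _ {n} (H : Graph n) (A₁ A₂ Bad₁ Big : VSet n) (Bad₂ : Fin n → VSet n) where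

    goodEdges : ℕ
    goodEdges = ∑[ x < n ] ∑[ y < n ] indic ((A₁ x ∧ A₂ y ∧ adj H x y) ∧ goodPair Bad₁ Big Bad₂ x y)

    goodEdges≤edges : goodEdges ≤ eCount H A₁ A₂
    goodEdges≤edges = ≤-trans (∑-mono-≤ (λ x → ∑-mono-≤ (λ y → indic-mono (edge⇐good x y))))
                              (≤-reflexive (sym (eCount-∑ H A₁ A₂)))
      where
      edge⇐good : ∀ x y → T ((A₁ x ∧ A₂ y ∧ adj H x y) ∧ goodPair Bad₁ Big Bad₂ x y) → T (A₁ x ∧ A₂ y ∧ adj H x y)
      edge⇐good x y = proj₁ ∘ Equivalence.to T-∧

    edges≤good+bad : eCount H A₁ A₂ ≤ goodEdges + badPairs A₂ Bad₁ Big Bad₂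
    edges≤good+bad = begin
      eCount H A₁ A₂
        ≡⟨ eCount-∑ H A₁ A₂ ⟩
      ∑[ x < n ] ∑[ y < n ] indic (A₁ x ∧ A₂ y ∧ adj H x y)
        ≤⟨ ∑-mono-≤ (λ x → ∑-mono-≤ (λ y → edge-cover (A₁ x) (A₂ y) (adj H x y) (Bad₁ x) (Big x) (Bad₂ x y))) ⟩
      ∑[ x < n ] ∑[ y < n ] (good x y + bad x y)
        ≡⟨ sum-cong-≗ (λ x → ∑-distrib-+ (good x) (bad x)) ⟩
      ∑[ x < n ] (∑[ y < n ] good x y + ∑[ y < n ] bad x y)
        ≡⟨ ∑-distrib-+ (λ x → ∑[ y < n ] good x y) (λ x → ∑[ y < n ] bad x y) ⟩
      goodEdges + ∑[ x < n ] ∑[ y < n ] bad x y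
        ≡⟨ cong (goodEdges +_) ∑bad ⟩
      goodEdges + badPairs A₂ Bad₁ Big Bad₂ ∎
      where
      open ≤-Reasoning
      good bad : Fin n → Fin n → ℕ
      good x y = indic ((A₁ x ∧ A₂ y ∧ adj H x y) ∧ goodPair Bad₁ Big Bad₂ x y)
      bad x y = indic (Bad₁ x) * indic (A₂ y) + indic (Big x) * indic (Bad₂ x y)
      row : ∀ x → ∑[ y < n ] bad x y ≡ indic (Bad₁ x) * size A₂ + indic (Big x) * size (Bad₂ x)
      row x = begin-equality
        ∑[ y < n ] bad x y
          ≡⟨ ∑-distrib-+ (λ y → indic (Bad₁ x) * indic (A₂ y)) (λ y → indic (Big x) * indic (Bad₂ x y)) ⟩
        ∑[ y < n ] (indic (Bad₁ x) * indic (A₂ y)) + ∑[ y < n ] (indic (Big x) * indic (Bad₂ x y))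
          ≡⟨ cong₂ _+_ (*-distribˡ-sum (indic (Bad₁ x)) (λ y → indic (A₂ y)))
                       (*-distribˡ-sum (indic (Big x)) (λ y → indic (Bad₂ x y))) ⟨
        indic (Bad₁ x) * ∑[ y < n ] indic (A₂ y) + indic (Big x) * ∑[ y < n ] indic (Bad₂ x y)
          ≡⟨ cong₂ (λ a b → indic (Bad₁ x) * a + indic (Big x) * b) (size-∑ A₂) (size-∑ (Bad₂ x)) ⟨
        indic (Bad₁ x) * size A₂ + indic (Big x) * size (Bad₂ x) ∎
      ∑bad : ∑[ x < n ] ∑[ y < n ] bad x y ≡ badPairs A₂ Bad₁ Big Bad₂
      ∑bad = begin-equality
        ∑[ x < n ] ∑[ y < n ] bad x y
          ≡⟨ sum-cong-≗ row ⟩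
        ∑[ x < n ] (indic (Bad₁ x) * size A₂ + indic (Big x) * size (Bad₂ x))
          ≡⟨ ∑-distrib-+ (λ x → indic (Bad₁ x) * size A₂) (λ x → indic (Big x) * size (Bad₂ x)) ⟩
        ∑[ x < n ] (indic (Bad₁ x) * size A₂) + ∑[ x < n ] (indic (Big x) * size (Bad₂ x))
          ≡⟨ cong (_+ ∑[ x < n ] (indic (Big x) * size (Bad₂ x))) (*-distribʳ-sum (size A₂) (λ x → indic (Bad₁ x))) ⟨
        (∑[ x < n ] indic (Bad₁ x)) * size A₂ + ∑[ x < n ] (indic (Big x) * size (Bad₂ x))
          ≡⟨ cong (λ a → a * size A₂ + ∑[ x < n ] (indic (Big x) * size (Bad₂ x))) (size-∑ Bad₁) ⟨
        badPairs A₂ Bad₁ Big Bad₂ ∎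

  module _ {n k} (c : Labelling n k) where

    inSomeB : VSet n
    inSomeB v with c v
    ... | inj₁ _ = false
    ... | inj₂ _ = true

    labelling-part : ∀ v → Part (isA c 0F v) (isA c 1F v) (inSomeB v)
    labelling-part v with c v
    ... | inj₁ 0F = in-A₁
    ... | inj₁ 1F = in-A₂
    ... | inj₂ _  = in-B

    ∑-isB : ∀ v → ∑[ j < k ] indic (isB c j v) ≡ indic (inSomeB v)
    ∑-isB v with c v
    ... | inj₁ _ = sum-replicate-zero k
    ... | inj₂ i = ∑-delta i

open Counting hiding (∑-mono-≤)

open import Data.Rational using (ℚ; 0ℚ; _≤_; _<_; _*_; _-_)
open import Data.Rational using (1ℚ; mkℚ; _+_; -_; _≤?_; _<?_; ∣_∣; nonNegative; positive)

ℚ-ring : ACR.AlmostCommutativeRing 0ℓ 0ℓ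
ℚ-ring = ACR.fromCommutativeRing ℚ.+-*-commutativeRing (λ x → dec⇒maybe (0ℚ ℚ.≟ x))

module ℕ∑ = SemiringSum ℕ.+-*-semiring
open SemiringSum (CommutativeRing.semiring ℚ.+-*-commutativeRing)
  using (sum; sum-syntax; sum-cong-≗; ∑-distrib-+; *-distribˡ-sum; *-distribʳ-sum)

ℕ→ℚ≡mkℚ : ∀ m → ℕ→ℚ m ≡ mkℚ (ℤ.+ m) 0 (coprime-sym (1-coprimeTo m))
ℕ→ℚ≡mkℚ m = ℚ.normalize-coprime (coprime-sym (1-coprimeTo m))

ℕ→ℚ-+ : ∀ m n → ℕ→ℚ (m ℕ.+ n) ≡ ℕ→ℚ m + ℕ→ℚ n
ℕ→ℚ-+ m n = trans (cong (λ i → i ℚ./ 1) (cong₂ ℤ._+_ (sym (ℤ.*-identityʳ (ℤ.+ m))) (sym (ℤ.*-identityʳ (ℤ.+ n)))))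
                  (sym (cong₂ _+_ (ℕ→ℚ≡mkℚ m) (ℕ→ℚ≡mkℚ n)))

ℕ→ℚ-* : ∀ m n → ℕ→ℚ (m ℕ.* n) ≡ ℕ→ℚ m * ℕ→ℚ n
ℕ→ℚ-* m n = trans (cong (λ i → i ℚ./ 1) (ℤ.pos-* m n)) (sym (cong₂ _*_ (ℕ→ℚ≡mkℚ m) (ℕ→ℚ≡mkℚ n)))

ℕ→ℚ-mono-≤ : ∀ {m n} → m ℕ.≤ n → ℕ→ℚ m ≤ ℕ→ℚ n
ℕ→ℚ-mono-≤ {m} {n} m≤n rewrite ℕ→ℚ≡mkℚ m | ℕ→ℚ≡mkℚ n =
  ℚ.*≤* (subst₂ ℤ._≤_ (sym (ℤ.*-identityʳ (ℤ.+ m))) (sym (ℤ.*-identityʳ (ℤ.+ n))) (ℤ.+≤+ m≤n))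

ℕ→ℚ-nonNeg : ∀ n → 0ℚ ≤ ℕ→ℚ n
ℕ→ℚ-nonNeg n = ℕ→ℚ-mono-≤ {0} {n} ℕ.z≤n

ℕ→ℚ-pos : ∀ n .{{_ : NonZero n}} → 0ℚ < ℕ→ℚ n
ℕ→ℚ-pos (ℕ.suc n) rewrite ℕ→ℚ≡mkℚ (ℕ.suc n) = ℚ.positive⁻¹ _

ℕ→ℚ-pos⁻¹ : ∀ {n} → 0ℚ < ℕ→ℚ n → NonZero n
ℕ→ℚ-pos⁻¹ {ℕ.zero}  0<0 = ⊥-elim (ℚ.<-irrefl refl 0<0)
ℕ→ℚ-pos⁻¹ {ℕ.suc n} _   = _

ℕ→ℚ-∑ : ∀ {n} (f : Fin n → ℕ) → ℕ→ℚ (ℕ∑.sum f) ≡ ∑[ i < n ] ℕ→ℚ (f i)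
ℕ→ℚ-∑ {ℕ.zero}  f = refl
ℕ→ℚ-∑ {ℕ.suc n} f = trans (ℕ→ℚ-+ (f zero) _) (cong (ℕ→ℚ (f zero) +_) (ℕ→ℚ-∑ (f ∘ suc)))

∑-mono-≤ : ∀ {n} {f g : Fin n → ℚ} → (∀ i → f i ≤ g i) → ∑[ i < n ] f i ≤ ∑[ i < n ] g i
∑-mono-≤ {ℕ.zero}  f≤g = ℚ.≤-refl
∑-mono-≤ {ℕ.suc n} f≤g = ℚ.+-mono-≤ (f≤g zero) (∑-mono-≤ (f≤g ∘ suc))

∑-const : ∀ k c → ∑[ j < k ] c ≡ ℕ→ℚ k * c
∑-const ℕ.zero    c = sym (ℚ.*-zeroˡ c)
∑-const (ℕ.suc k) c = begin
  c + ∑[ j < k ] c       ≡⟨ cong (c +_) (∑-const k c) ⟩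
  c + ℕ→ℚ k * c          ≡⟨ cong (_+ ℕ→ℚ k * c) (ℚ.*-identityˡ c) ⟨
  1ℚ * c + ℕ→ℚ k * c     ≡⟨ ℚ.*-distribʳ-+ c 1ℚ (ℕ→ℚ k) ⟨
  (1ℚ + ℕ→ℚ k) * c       ≡⟨ cong (_* c) (ℕ→ℚ-+ 1 k) ⟨
  ℕ→ℚ (ℕ.suc k) * c      ∎
  where open ≡-Reasoning

sumQ-∑ : ∀ k (f : Fin k → ℚ) → sumQ k f ≡ ∑[ j < k ] f j
sumQ-∑ k f = foldr-tabulate _+_ 0ℚ f id

∑-affine : ∀ k a b (f : Fin k → ℚ) → ∑[ j < k ] (a * f j - b) ≡ a * ∑[ j < k ] f j - ℕ→ℚ k * b
∑-affine k a b f = begin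
  ∑[ j < k ] (a * f j - b)                    ≡⟨ ∑-distrib-+ (λ j → a * f j) (λ _ → - b) ⟩
  ∑[ j < k ] (a * f j) + ∑[ j < k ] (- b)     ≡⟨ cong₂ _+_ (*-distribˡ-sum a f) (sym (∑-const k (- b))) ⟨
  a * ∑[ j < k ] f j + ℕ→ℚ k * (- b)          ≡⟨ cong (a * ∑[ j < k ] f j +_) (sym (ℚ.neg-distribʳ-* (ℕ→ℚ k) b)) ⟩
  a * ∑[ j < k ] f j - ℕ→ℚ k * b              ∎
  where open ≡-Reasoning

*-monoˡ-≤ : ∀ {r p q} → 0ℚ ≤ r → p ≤ q → r * p ≤ r * q
*-monoˡ-≤ {r} 0≤r = ℚ.*-monoˡ-≤-nonNeg r {{nonNegative 0≤r}}

*-monoʳ-≤ : ∀ {r p q} → 0ℚ ≤ r → p ≤ q → p * r ≤ q * r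
*-monoʳ-≤ {r} 0≤r = ℚ.*-monoʳ-≤-nonNeg r {{nonNegative 0≤r}}

*-nonNeg : ∀ {p q} → 0ℚ ≤ p → 0ℚ ≤ q → 0ℚ ≤ p * q
*-nonNeg {p} {q} 0≤p 0≤q = subst (_≤ p * q) (ℚ.*-zeroˡ q) (*-monoʳ-≤ 0≤q 0≤p)

*-pos : ∀ {p q} → 0ℚ < p → 0ℚ < q → 0ℚ < p * q
*-pos {p} {q} 0<p 0<q = ℚ.positive⁻¹ (p * q) {{ℚ.pos*pos⇒pos p {{positive 0<p}} q {{positive 0<q}}}}

-‿mono-≤ : ∀ {a b c d} → a ≤ b → c ≤ d → a - d ≤ b - c
-‿mono-≤ a≤b c≤d = ℚ.+-mono-≤ a≤b (ℚ.neg-antimono-≤ c≤d)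

p≤∣p∣ : ∀ p → p ≤ ∣ p ∣
p≤∣p∣ p with ℚ.∣p∣≡p∨∣p∣≡-p p
... | inj₁ ∣p∣≡p  = ℚ.≤-reflexive (sym ∣p∣≡p)
... | inj₂ ∣p∣≡-p = ℚ.≤-trans p≤0 (ℚ.0≤∣p∣ p)
  where
  neg-involutive : ∀ p → - (- p) ≡ p
  neg-involutive = solve-∀ ℚ-ring
  p≤0 : p ≤ 0ℚ
  p≤0 = subst (_≤ 0ℚ) (neg-involutive p) (ℚ.neg-antimono-≤ (subst (0ℚ ≤_) ∣p∣≡-p (ℚ.0≤∣p∣ p)))

q-p≤∣p-q∣ : ∀ p q → q - p ≤ ∣ p - q ∣
q-p≤∣p-q∣ p q = begin
  q - p          ≡⟨ flip p q ⟩
  - (p - q)      ≤⟨ p≤∣p∣ (- (p - q)) ⟩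
  ∣ - (p - q) ∣  ≡⟨ ℚ.∣-p∣≡∣p∣ (p - q) ⟩
  ∣ p - q ∣      ∎
  where
  open ℚ.≤-Reasoning
  flip : ∀ p q → q - p ≡ - (p - q)
  flip = solve-∀ ℚ-ring

ratio-* : ∀ e m .{{_ : NonZero m}} → ratio e m * ℕ→ℚ m ≡ ℕ→ℚ e
ratio-* e (ℕ.suc m) = ℚ.toℚᵘ-injective (begin
  ℚ.toℚᵘ (ratio e (ℕ.suc m) * ℕ→ℚ (ℕ.suc m))
    ≈⟨ ℚ.toℚᵘ-homo-* (ratio e (ℕ.suc m)) (ℕ→ℚ (ℕ.suc m)) ⟩
  ℚ.toℚᵘ (ratio e (ℕ.suc m)) ℚᵘ.* ℚ.toℚᵘ (ℕ→ℚ (ℕ.suc m))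
    ≈⟨ ℚᵘ.*-cong (ℚ.toℚᵘ-fromℚᵘ (ℚᵘ.mkℚᵘ (ℤ.+ e) m)) (ℚ.toℚᵘ-fromℚᵘ (ℚᵘ.mkℚᵘ (ℤ.+ ℕ.suc m) 0)) ⟩
  ℚᵘ.mkℚᵘ (ℤ.+ e) m ℚᵘ.* ℚᵘ.mkℚᵘ (ℤ.+ ℕ.suc m) 0
    ≈⟨ ℚᵘ.*≡* (ℤ.*-assoc (ℤ.+ e) (ℤ.+ ℕ.suc m) (ℤ.+ 1)) ⟩
  ℚᵘ.mkℚᵘ (ℤ.+ e) 0
    ≈⟨ ℚ.toℚᵘ-fromℚᵘ (ℚᵘ.mkℚᵘ (ℤ.+ e) 0) ⟨
  ℚ.toℚᵘ (ℕ→ℚ e) ∎)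
  where open ℚᵘ.≃-Reasoning

ratio-≤ : ∀ e m {q} .{{_ : NonZero m}} → ℕ→ℚ e ≤ q * ℕ→ℚ m → ratio e m ≤ q
ratio-≤ e m e≤qm = ℚ.*-cancelʳ-≤-pos (ℕ→ℚ m) {{positive (ℕ→ℚ-pos m)}} (subst (_≤ _) (sym (ratio-* e m)) e≤qm)

≤-ratio : ∀ e m {q} .{{_ : NonZero m}} → q * ℕ→ℚ m ≤ ℕ→ℚ e → q ≤ ratio e m
≤-ratio e m qm≤e = ℚ.*-cancelʳ-≤-pos (ℕ→ℚ m) {{positive (ℕ→ℚ-pos m)}} (subst (_ ≤_) (sym (ratio-* e m)) qm≤e)

indic-scaled-≤ : ∀ p m {c} → (T p → ℕ→ℚ m ≤ c) → ℕ→ℚ (indic p ℕ.* m) ≤ ℕ→ℚ (indic p) * c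
indic-scaled-≤ false m {c} _   = ℚ.≤-reflexive (sym (ℚ.*-zeroˡ c))
indic-scaled-≤ true  m {c} m≤c = subst₂ _≤_ (cong ℕ→ℚ (sym (ℕ.*-identityˡ m))) (sym (ℚ.*-identityˡ c)) (m≤c tt)

indic-scaled-≥ : ∀ p m {c} → (T p → c ≤ ℕ→ℚ m) → ℕ→ℚ (indic p) * c ≤ ℕ→ℚ (indic p ℕ.* m)
indic-scaled-≥ false m {c} _   = ℚ.≤-reflexive (ℚ.*-zeroˡ c)
indic-scaled-≥ true  m {c} c≤m = subst₂ _≤_ (sym (ℚ.*-identityˡ c)) (cong ℕ→ℚ (sym (ℕ.*-identityˡ m))) (c≤m tt)

module _ {n} {u v : Fin n → ℕ} {c : ℚ} where

  ℕ→ℚ-∑-* : ℕ→ℚ (ℕ∑.sum u) * c ≡ ∑[ i < n ] (ℕ→ℚ (u i) * c)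
  ℕ→ℚ-∑-* = trans (cong (_* c) (ℕ→ℚ-∑ u)) (*-distribʳ-sum c (λ i → ℕ→ℚ (u i)))

  ∑-scaled-≤ : (∀ i → ℕ→ℚ (v i) ≤ ℕ→ℚ (u i) * c) → ℕ→ℚ (ℕ∑.sum v) ≤ ℕ→ℚ (ℕ∑.sum u) * c
  ∑-scaled-≤ v≤uc = begin
    ℕ→ℚ (ℕ∑.sum v)                ≡⟨ ℕ→ℚ-∑ v ⟩
    ∑[ i < n ] ℕ→ℚ (v i)          ≤⟨ ∑-mono-≤ v≤uc ⟩
    ∑[ i < n ] (ℕ→ℚ (u i) * c)    ≡⟨ ℕ→ℚ-∑-* ⟨
    ℕ→ℚ (ℕ∑.sum u) * c            ∎
    where open ℚ.≤-Reasoning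

  ∑-scaled-≥ : (∀ i → ℕ→ℚ (u i) * c ≤ ℕ→ℚ (v i)) → ℕ→ℚ (ℕ∑.sum u) * c ≤ ℕ→ℚ (ℕ∑.sum v)
  ∑-scaled-≥ uc≤v = begin
    ℕ→ℚ (ℕ∑.sum u) * c            ≡⟨ ℕ→ℚ-∑-* ⟩
    ∑[ i < n ] (ℕ→ℚ (u i) * c)    ≤⟨ ∑-mono-≤ uc≤v ⟩
    ∑[ i < n ] ℕ→ℚ (v i)          ≡⟨ ℕ→ℚ-∑ v ⟨
    ℕ→ℚ (ℕ∑.sum v)                ∎
    where open ℚ.≤-Reasoning

-- s and c stand for the number of neighbours of x in B and of common neighbours of x and y in B.
codegree-bound : ∀ {d₁ d₂ ε t s c} → 0ℚ ≤ d₁ → 0ℚ ≤ d₂ → d₂ ≤ 1ℚ → 0ℚ ≤ ε → 0ℚ ≤ t →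
                 (d₁ - ε) * t ≤ s → s ≤ t → s < ε * t ⊎ (d₂ - ε) * s ≤ c → 0ℚ ≤ c →
                 t * (d₁ * d₂) - ℕ→ℚ 2 * ε * t ≤ c
codegree-bound {d₁} {d₂} {ε} {t} {s} {c} 0≤d₁ 0≤d₂ d₂≤1 0≤ε 0≤t low s≤t (inj₁ s<εt) 0≤c = begin
  t * (d₁ * d₂) - ℕ→ℚ 2 * ε * t      ≤⟨ -‿mono-≤ t[d₁d₂]≤2εt (ℚ.≤-refl {ℕ→ℚ 2 * ε * t}) ⟩
  ℕ→ℚ 2 * ε * t - ℕ→ℚ 2 * ε * t      ≡⟨ ℚ.+-inverseʳ (ℕ→ℚ 2 * ε * t) ⟩
  0ℚ                                 ≤⟨ 0≤c ⟩
  c                                  ∎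
  where
  open ℚ.≤-Reasoning
  split : ∀ d e t → t * d ≡ (d - e) * t + e * t
  split = solve-∀ ℚ-ring
  double : ∀ e t → e * t + e * t ≡ ℕ→ℚ 2 * e * t
  double = solve-∀ ℚ-ring
  t[d₁d₂]≤2εt : t * (d₁ * d₂) ≤ ℕ→ℚ 2 * ε * t
  t[d₁d₂]≤2εt = begin
    t * (d₁ * d₂)          ≤⟨ *-monoˡ-≤ 0≤t (ℚ.≤-trans (*-monoˡ-≤ 0≤d₁ d₂≤1) (ℚ.≤-reflexive (ℚ.*-identityʳ d₁))) ⟩
    t * d₁                 ≡⟨ split d₁ ε t ⟩
    (d₁ - ε) * t + ε * t   ≤⟨ ℚ.+-monoˡ-≤ (ε * t) (ℚ.≤-trans low (ℚ.<⇒≤ s<εt)) ⟩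
    ε * t + ε * t          ≡⟨ double ε t ⟩
    ℕ→ℚ 2 * ε * t          ∎
codegree-bound {d₁} {d₂} {ε} {t} {s} {c} 0≤d₁ 0≤d₂ d₂≤1 0≤ε 0≤t low s≤t (inj₂ common) 0≤c = begin
  t * (d₁ * d₂) - ℕ→ℚ 2 * ε * t                         ≡⟨ regroup t d₁ d₂ ε ⟩
  (d₂ * ((d₁ - ε) * t) - ε * t) + (ε * t * d₂ - ε * t)
    ≤⟨ ℚ.+-mono-≤ (-‿mono-≤ (*-monoˡ-≤ 0≤d₂ low) (*-monoˡ-≤ 0≤ε s≤t)) εtd₂-εt≤0 ⟩
  (d₂ * s - ε * s) + 0ℚ                                 ≡⟨ factor d₂ ε s ⟩
  (d₂ - ε) * s                                          ≤⟨ common ⟩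
  c                                                     ∎
  where
  open ℚ.≤-Reasoning
  regroup : ∀ t d₁ d₂ ε → t * (d₁ * d₂) - ℕ→ℚ 2 * ε * t ≡ (d₂ * ((d₁ - ε) * t) - ε * t) + (ε * t * d₂ - ε * t)
  regroup = solve-∀ ℚ-ring
  factor : ∀ d e s → (d * s - e * s) + 0ℚ ≡ (d - e) * s
  factor = solve-∀ ℚ-ring
  εtd₂-εt≤0 : ε * t * d₂ - ε * t ≤ 0ℚ
  εtd₂-εt≤0 = begin
    ε * t * d₂ - ε * t     ≤⟨ -‿mono-≤ (*-monoˡ-≤ (*-nonNeg 0≤ε 0≤t) d₂≤1) (ℚ.≤-refl {ε * t}) ⟩
    ε * t * 1ℚ - ε * t     ≡⟨ cong (_- ε * t) (ℚ.*-identityʳ (ε * t)) ⟩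
    ε * t - ε * t          ≡⟨ ℚ.+-inverseʳ (ε * t) ⟩
    0ℚ                     ∎

module _ {n} (H : Graph n) where

  ≤-density : ∀ X Y {q} .{{_ : NonZero (size X ℕ.* size Y)}} →
              q * ℕ→ℚ (size X ℕ.* size Y) ≤ ℕ→ℚ (eCount H X Y) → q ≤ density H X Y
  ≤-density X Y = ≤-ratio (eCount H X Y) (size X ℕ.* size Y)

  density-≤ : ∀ X Y {θ} .{{_ : NonZero (size X ℕ.* size Y)}} →
              (∀ x → T (X x) → ℕ→ℚ (deg H Y x) ≤ θ * ℕ→ℚ (size Y)) → density H X Y ≤ θ
  density-≤ X Y {θ} low = ratio-≤ (eCount H X Y) (size X ℕ.* size Y) (begin
    ℕ→ℚ (eCount H X Y)                                ≡⟨ cong ℕ→ℚ (eCount-deg H X Y) ⟩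
    ℕ→ℚ (ℕ∑.sum (λ x → indic (X x) ℕ.* deg H Y x))    ≤⟨ ∑-scaled-≤ (λ x → indic-scaled-≤ (X x) (deg H Y x) (low x)) ⟩
    ℕ→ℚ (ℕ∑.sum (λ x → indic (X x))) * θY            ≡⟨ cong (λ m → ℕ→ℚ m * θY) (size-∑ X) ⟨
    ℕ→ℚ (size X) * θY                                ≡⟨ reorder (ℕ→ℚ (size X)) θ (ℕ→ℚ (size Y)) ⟩
    θ * (ℕ→ℚ (size X) * ℕ→ℚ (size Y))                ≡⟨ cong (θ *_) (ℕ→ℚ-* (size X) (size Y)) ⟨
    θ * ℕ→ℚ (size X ℕ.* size Y)                      ∎)
    where
    open ℚ.≤-Reasoning
    θY : ℚ
    θY = θ * ℕ→ℚ (size Y)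
    reorder : ∀ a b c → a * (b * c) ≡ b * (a * c)
    reorder = solve-∀ ℚ-ring

  lowDegree : VSet n → VSet n → ℚ → VSet n
  lowDegree A Y θ x = A x ∧ ⌊ ℕ→ℚ (deg H Y x) <? θ * ℕ→ℚ (size Y) ⌋

  lowDegree-small : ∀ ε A B Y θ .{{_ : NonZero (size Y)}} → 0ℚ ≤ ε → Uniform H ε A B → Y ⊆ B →
                    ε * ℕ→ℚ (size B) ≤ ℕ→ℚ (size Y) → θ + ε ≤ density H A B →
                    ℕ→ℚ (size (lowDegree A Y θ)) ≤ ε * ℕ→ℚ (size A)
  lowDegree-small ε A B Y θ 0≤ε uniform Y⊆B εB≤Y dense =
    ℚ.≮⇒≥ λ εA<X → ℚ.<-irrefl refl (ℚ.≤-<-trans (gap εA<X) (close εA<X))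
    where
    X : VSet n
    X = lowDegree A Y θ
    XY≢∅ : ε * ℕ→ℚ (size A) < ℕ→ℚ (size X) → NonZero (size X ℕ.* size Y)
    XY≢∅ εA<X = ℕ.m*n≢0 (size X) (size Y) {{ℕ→ℚ-pos⁻¹ (ℚ.≤-<-trans (*-nonNeg 0≤ε (ℕ→ℚ-nonNeg (size A))) εA<X)}}
    close : ε * ℕ→ℚ (size A) < ℕ→ℚ (size X) → ∣ density H X Y - density H A B ∣ < ε
    close εA<X = uniform X Y (λ v → proj₁ ∘ Equivalence.to T-∧) Y⊆B (ℚ.<⇒≤ εA<X) εB≤Y
    sparse : ε * ℕ→ℚ (size A) < ℕ→ℚ (size X) → density H X Y ≤ θ
    sparse εA<X = density-≤ X Y {{XY≢∅ εA<X}} (λ x x∈X → ℚ.<⇒≤ (toWitness (proj₂ (Equivalence.to (T-∧ {A x}) x∈X))))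
    gap : ε * ℕ→ℚ (size A) < ℕ→ℚ (size X) → ε ≤ ∣ density H X Y - density H A B ∣
    gap εA<X = begin
      ε                                  ≡⟨ cancel θ ε ⟨
      (θ + ε) - θ                        ≤⟨ -‿mono-≤ dense (sparse εA<X) ⟩
      density H A B - density H X Y      ≤⟨ q-p≤∣p-q∣ (density H X Y) (density H A B) ⟩
      ∣ density H X Y - density H A B ∣  ∎
      where
      open ℚ.≤-Reasoning
      cancel : ∀ a b → (a + b) - a ≡ b
      cancel = solve-∀ ℚ-ring

  lowDegree-complement : ∀ A Y θ x → T (A x) → T (not (lowDegree A Y θ x)) →
                         θ * ℕ→ℚ (size Y) ≤ ℕ→ℚ (deg H Y x)
  lowDegree-complement A Y θ x x∈A x∉low = ℚ.≮⇒≥ λ low →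
    T-not-elim (Equivalence.from (T-∧ {A x}) (x∈A , fromWitness {a? = ℕ→ℚ (deg H Y x) <? θ * ℕ→ℚ (size Y)} low)) x∉low

module _ {n} (H : Graph n) (ε : ℚ) (0<ε : 0ℚ < ε) (t : ℕ) .{{_ : NonZero t}} (A₁ A₂ B : VSet n)
         (∣A₁∣≡t : size A₁ ≡ t) (∣A₂∣≡t : size A₂ ≡ t) (∣B∣≡t : size B ≡ t)
         (uniform₁ : Uniform H ε A₁ B) (uniform₂ : Uniform H ε A₂ B)
         (d₁ d₂ : ℚ) (0≤d₁ : 0ℚ ≤ d₁) (0≤d₂ : 0ℚ ≤ d₂)
         (dense₁ : d₁ * (ℕ→ℚ t * ℕ→ℚ t) ≤ ℕ→ℚ (eCount H A₁ B))
         (dense₂ : d₂ * (ℕ→ℚ t * ℕ→ℚ t) ≤ ℕ→ℚ (eCount H A₂ B)) where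

  private
    τ : ℚ
    τ = ℕ→ℚ t

    0≤ε : 0ℚ ≤ ε
    0≤ε = ℚ.<⇒≤ 0<ε

    0≤τ : 0ℚ ≤ τ
    0≤τ = ℕ→ℚ-nonNeg t

    size≡τ : ∀ {X : VSet n} → size X ≡ t → ℕ→ℚ (size X) ≡ τ
    size≡τ = cong ℕ→ℚ

    nonEmpty : ∀ (X : VSet n) → size X ≡ t → NonZero (size X)
    nonEmpty X ∣X∣≡t = ℕ.≢-nonZero (subst (_≢ 0) (sym ∣X∣≡t) (ℕ.≢-nonZero⁻¹ t))

    instance
      B-nonEmpty : NonZero (size B)
      B-nonEmpty = nonEmpty B ∣B∣≡t

    ℕ→ℚ-size² : ∀ (X : VSet n) → size X ≡ t → ℕ→ℚ (size X ℕ.* size B) ≡ τ * τ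
    ℕ→ℚ-size² X ∣X∣≡t = trans (ℕ→ℚ-* (size X) (size B)) (cong₂ _*_ (size≡τ ∣X∣≡t) (size≡τ ∣B∣≡t))

    density-shift : ∀ (X : VSet n) → size X ≡ t → ∀ d →
                    d * (τ * τ) ≤ ℕ→ℚ (eCount H X B) → (d - ε) + ε ≤ density H X B
    density-shift X ∣X∣≡t d dense = subst (_≤ density H X B) (sym (minus-plus d ε))
      (≤-density H X B {{ℕ.m*n≢0 (size X) (size B) {{nonEmpty X ∣X∣≡t}}}}
        (subst (λ m → d * m ≤ ℕ→ℚ (eCount H X B)) (sym (ℕ→ℚ-size² X ∣X∣≡t)) dense))
      where
      minus-plus : ∀ a b → (a - b) + b ≡ a
      minus-plus = solve-∀ ℚ-ring

    d₂≤1 : d₂ ≤ 1ℚ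
    d₂≤1 = ℚ.*-cancelʳ-≤-pos (τ * τ) {{positive 0<τ²}} (begin
      d₂ * (τ * τ)                    ≤⟨ dense₂ ⟩
      ℕ→ℚ (eCount H A₂ B)             ≤⟨ ℕ→ℚ-mono-≤ (eCount≤size*size H A₂ B) ⟩
      ℕ→ℚ (size A₂ ℕ.* size B)        ≡⟨ ℕ→ℚ-size² A₂ ∣A₂∣≡t ⟩
      τ * τ                           ≡⟨ ℚ.*-identityˡ (τ * τ) ⟨
      1ℚ * (τ * τ)                    ∎)
      where
      open ℚ.≤-Reasoning
      0<τ² : 0ℚ < τ * τ
      0<τ² = *-pos (ℕ→ℚ-pos t) (ℕ→ℚ-pos t)

    Bad₁ Big : VSet n
    Bad₁ = lowDegree H A₁ B (d₁ - ε)
    Big x = A₁ x ∧ ⌊ ε * ℕ→ℚ (size B) ≤? ℕ→ℚ (deg H B x) ⌋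

    Bad₂ : Fin n → VSet n
    Bad₂ x = lowDegree H A₂ (N H B x) (d₂ - ε)

    -- A with-abstraction on ε ≤? 1ℚ in this module exhausts Agda's memory, hence ≤-total.
    bad₁-small : ℕ→ℚ (size Bad₁) ≤ ε * τ
    bad₁-small = [ uniformity , trivially ]′ (ℚ.≤-total ε 1ℚ)
      where
      open ℚ.≤-Reasoning
      uniformity : ε ≤ 1ℚ → ℕ→ℚ (size Bad₁) ≤ ε * τ
      uniformity ε≤1 = subst (λ a → ℕ→ℚ (size Bad₁) ≤ ε * a) (size≡τ ∣A₁∣≡t)
        (lowDegree-small H ε A₁ B B (d₁ - ε) 0≤ε uniform₁ (λ _ → id)
                         εB≤B (density-shift A₁ ∣A₁∣≡t d₁ dense₁))
        where
        εB≤B : ε * ℕ→ℚ (size B) ≤ ℕ→ℚ (size B)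
        εB≤B = ℚ.≤-trans (*-monoʳ-≤ (ℕ→ℚ-nonNeg (size B)) ε≤1) (ℚ.≤-reflexive (ℚ.*-identityˡ (ℕ→ℚ (size B))))
      trivially : 1ℚ ≤ ε → ℕ→ℚ (size Bad₁) ≤ ε * τ
      trivially 1≤ε = begin
        ℕ→ℚ (size Bad₁)   ≤⟨ ℕ→ℚ-mono-≤ (size-mono {X = Bad₁} {A₁} (λ _ → proj₁ ∘ Equivalence.to T-∧)) ⟩
        ℕ→ℚ (size A₁)     ≡⟨ size≡τ ∣A₁∣≡t ⟩
        τ                 ≡⟨ ℚ.*-identityˡ τ ⟨
        1ℚ * τ            ≤⟨ *-monoʳ-≤ 0≤τ 1≤ε ⟩
        ε * τ             ∎

    bad₂-small : ∀ x → T (Big x) → ℕ→ℚ (size (Bad₂ x)) ≤ ε * τ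
    bad₂-small x x∈Big = subst (λ a → ℕ→ℚ (size (Bad₂ x)) ≤ ε * a) (size≡τ ∣A₂∣≡t)
      (lowDegree-small H ε A₂ B (N H B x) (d₂ - ε) {{nonEmpty-N}} 0≤ε uniform₂ (λ _ → proj₁ ∘ Equivalence.to T-∧)
                       εB≤deg (density-shift A₂ ∣A₂∣≡t d₂ dense₂))
      where
      εB≤deg : ε * ℕ→ℚ (size B) ≤ ℕ→ℚ (deg H B x)
      εB≤deg = toWitness (proj₂ (Equivalence.to (T-∧ {A₁ x}) x∈Big))
      nonEmpty-N : NonZero (size (N H B x))
      nonEmpty-N = ℕ→ℚ-pos⁻¹ (ℚ.<-≤-trans (*-pos 0<ε (ℕ→ℚ-pos (size B))) εB≤deg)

    badPairs-small : ℕ→ℚ (badPairs A₂ Bad₁ Big Bad₂) ≤ ℕ→ℚ 2 * ε * (τ * τ)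
    badPairs-small = begin
      ℕ→ℚ (size Bad₁ ℕ.* size A₂ ℕ.+ ℕ∑.sum bigBad)
        ≡⟨ ℕ→ℚ-+ (size Bad₁ ℕ.* size A₂) (ℕ∑.sum bigBad) ⟩
      ℕ→ℚ (size Bad₁ ℕ.* size A₂) + ℕ→ℚ (ℕ∑.sum bigBad)
        ≡⟨ cong (_+ ℕ→ℚ (ℕ∑.sum bigBad)) (trans (ℕ→ℚ-* (size Bad₁) (size A₂))
                                               (cong (ℕ→ℚ (size Bad₁) *_) (size≡τ ∣A₂∣≡t))) ⟩
      ℕ→ℚ (size Bad₁) * τ + ℕ→ℚ (ℕ∑.sum bigBad)
        ≤⟨ ℚ.+-mono-≤ (*-monoʳ-≤ 0≤τ bad₁-small) bigBad-small ⟩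
      ε * τ * τ + τ * (ε * τ)
        ≡⟨ collect ε τ ⟩
      ℕ→ℚ 2 * ε * (τ * τ) ∎
      where
      open ℚ.≤-Reasoning
      bigBad : Fin n → ℕ
      bigBad x = indic (Big x) ℕ.* size (Bad₂ x)
      collect : ∀ e t → e * t * t + t * (e * t) ≡ ℕ→ℚ 2 * e * (t * t)
      collect = solve-∀ ℚ-ring
      bigBad-small : ℕ→ℚ (ℕ∑.sum bigBad) ≤ τ * (ε * τ)
      bigBad-small = begin
        ℕ→ℚ (ℕ∑.sum bigBad)
          ≤⟨ ∑-scaled-≤ (λ x → indic-scaled-≤ (Big x) (size (Bad₂ x)) (bad₂-small x)) ⟩
        ℕ→ℚ (ℕ∑.sum (λ x → indic (Big x))) * (ε * τ)
          ≡⟨ cong (λ m → ℕ→ℚ m * (ε * τ)) (size-∑ Big) ⟨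
        ℕ→ℚ (size Big) * (ε * τ)
          ≤⟨ *-monoʳ-≤ (*-nonNeg 0≤ε 0≤τ) (ℕ→ℚ-mono-≤ (size-mono {X = Big} {A₁} (λ _ → proj₁ ∘ Equivalence.to T-∧))) ⟩
        ℕ→ℚ (size A₁) * (ε * τ)
          ≡⟨ cong (_* (ε * τ)) (size≡τ ∣A₁∣≡t) ⟩
        τ * (ε * τ) ∎

    goodEdge : Fin n → Fin n → Bool
    goodEdge x y = (A₁ x ∧ A₂ y ∧ adj H x y) ∧ goodPair Bad₁ Big Bad₂ x y

    goodEdge-codegree : ∀ x y → T (goodEdge x y) → τ * (d₁ * d₂) - ℕ→ℚ 2 * ε * τ ≤ ℕ→ℚ (codegree H B x y)
    goodEdge-codegree x y good-edge =
      codegree-bound 0≤d₁ 0≤d₂ d₂≤1 0≤ε 0≤τ (subst (λ a → (d₁ - ε) * a ≤ s) (size≡τ ∣B∣≡t) low)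
        (subst (s ≤_) (size≡τ ∣B∣≡t) (ℕ→ℚ-mono-≤ (deg≤size H B x))) dichotomy (ℕ→ℚ-nonNeg (codegree H B x y))
      where
      s : ℚ
      s = ℕ→ℚ (deg H B x)
      edge : T (A₁ x ∧ A₂ y ∧ adj H x y)
      edge = proj₁ (Equivalence.to (T-∧ {A₁ x ∧ A₂ y ∧ adj H x y}) good-edge)
      x∈A₁ : T (A₁ x)
      x∈A₁ = proj₁ (Equivalence.to (T-∧ {A₁ x}) edge)
      y∈A₂ : T (A₂ y)
      y∈A₂ = proj₁ (Equivalence.to (T-∧ {A₂ y}) (proj₂ (Equivalence.to (T-∧ {A₁ x}) edge)))
      good : T (goodPair Bad₁ Big Bad₂ x y)
      good = proj₂ (Equivalence.to (T-∧ {A₁ x ∧ A₂ y ∧ adj H x y}) good-edge)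
      low : (d₁ - ε) * ℕ→ℚ (size B) ≤ s
      low = lowDegree-complement H A₁ B (d₁ - ε) x x∈A₁ (proj₁ (Equivalence.to (T-∧ {not (Bad₁ x)}) good))
      dichotomy : s < ε * τ ⊎ (d₂ - ε) * s ≤ ℕ→ℚ (codegree H B x y)
      dichotomy with Equivalence.to T-∨ (proj₂ (Equivalence.to (T-∧ {not (Bad₁ x)}) good))
      ... | inj₁ x∉Big = inj₁ (subst (λ a → s < ε * a) (size≡τ ∣B∣≡t)
                          (ℚ.≰⇒> λ big → T-not-elim (Equivalence.from (T-∧ {A₁ x}) (x∈A₁ , fromWitness big)) x∉Big))
      ... | inj₂ y∉Bad₂ = inj₂ (lowDegree-complement H A₂ (N H B x) (d₂ - ε) y y∈A₂ y∉Bad₂)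

  trianglesAcross-≥ : τ * (ℕ→ℚ (eCount H A₁ A₂) - ℕ→ℚ 2 * ε * (τ * τ)) * (d₁ * d₂)
                        - ℕ→ℚ 2 * ε * τ * ℕ→ℚ (eCount H A₁ A₂)
                      ≤ ℕ→ℚ (trianglesAcross H A₁ A₂ B)
  trianglesAcross-≥ = begin
    τ * (e - 2ετ²) * (d₁ * d₂) - 2ετ * e
      ≡⟨ regroup τ e 2ετ² d₁ d₂ (ℕ→ℚ 2 * ε) ⟩
    (e - 2ετ²) * D - 2ετ * e
      ≤⟨ -‿mono-≤ (*-monoʳ-≤ 0≤D e-2ετ²≤G) (*-monoˡ-≤ 0≤2ετ G≤e) ⟩
    G * D - 2ετ * G
      ≡⟨ factor G D 2ετ ⟩
    G * (D - 2ετ)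
      ≤⟨ ∑-scaled-≥ (λ x → ∑-scaled-≥ (λ y →
           indic-scaled-≥ (goodEdge x y) (codegree H B x y) (goodEdge-codegree x y))) ⟩
    ℕ→ℚ (ℕ∑.sum (λ x → ℕ∑.sum (λ y → indic (goodEdge x y) ℕ.* codegree H B x y)))
      ≤⟨ ℕ→ℚ-mono-≤ (∑∑-indic-mono {p = goodEdge} {q = edge} (codegree H B) (λ x y → proj₁ ∘ Equivalence.to T-∧)) ⟩
    ℕ→ℚ (trianglesAcross H A₁ A₂ B) ∎
    where
    open ℚ.≤-Reasoning
    edge : Fin n → Fin n → Bool
    edge x y = A₁ x ∧ A₂ y ∧ adj H x y
    e G b D 2ετ 2ετ² : ℚ
    e = ℕ→ℚ (eCount H A₁ A₂)
    G = ℕ→ℚ (goodEdges H A₁ A₂ Bad₁ Big Bad₂)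
    b = ℕ→ℚ (badPairs A₂ Bad₁ Big Bad₂)
    D = τ * (d₁ * d₂)
    2ετ = ℕ→ℚ 2 * ε * τ
    2ετ² = ℕ→ℚ 2 * ε * (τ * τ)
    regroup : ∀ t e b d₁ d₂ c → t * (e - b) * (d₁ * d₂) - c * t * e ≡ (e - b) * (t * (d₁ * d₂)) - c * t * e
    regroup = solve-∀ ℚ-ring
    factor : ∀ g d c → g * d - c * g ≡ g * (d - c)
    factor = solve-∀ ℚ-ring
    0≤D : 0ℚ ≤ D
    0≤D = *-nonNeg 0≤τ (*-nonNeg 0≤d₁ 0≤d₂)
    0≤2ετ : 0ℚ ≤ 2ετ
    0≤2ετ = *-nonNeg (*-nonNeg (ℕ→ℚ-nonNeg 2) 0≤ε) 0≤τ
    G≤e : G ≤ e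
    G≤e = ℕ→ℚ-mono-≤ (goodEdges≤edges H A₁ A₂ Bad₁ Big Bad₂)
    e-2ετ²≤G : e - 2ετ² ≤ G
    e-2ετ²≤G = begin
      e - 2ετ²       ≤⟨ -‿mono-≤ e≤G+b badPairs-small ⟩
      (G + b) - b    ≡⟨ cancel G b ⟩
      G              ∎
      where
      cancel : ∀ g b → (g + b) - b ≡ g
      cancel = solve-∀ ℚ-ring
      e≤G+b : e ≤ G + b
      e≤G+b = ℚ.≤-trans (ℕ→ℚ-mono-≤ (edges≤good+bad H A₁ A₂ Bad₁ Big Bad₂))
                        (ℚ.≤-reflexive (ℕ→ℚ-+ (goodEdges H A₁ A₂ Bad₁ Big Bad₂) (badPairs A₂ Bad₁ Big Bad₂)))

lemma4 : (ε : ℚ) → 0ℚ < ε → (k t n : ℕ) → .{{_ : NonZero k}} → .{{_ : NonZero t}} →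
    (H : Graph n) → (c : Labelling n k) →
    (∀ i → size (isA c i) ≡ t) → (∀ j → size (isB c j) ≡ t) →
    (d : Fin 2 → Fin k → ℚ) → (∀ i j → 0ℚ ≤ d i j) →
    (∀ i j → Uniform H ε (isA c i) (isB c j)) →
    (∀ i j → d i j * (ℕ→ℚ t * ℕ→ℚ t) ≤ ℕ→ℚ (eCount H (isA c i) (isB c j))) →
    ℕ→ℚ t * (ℕ→ℚ (eCount H (isA c zero) (isA c (suc zero)))
               - ℕ→ℚ 2 * ε * (ℕ→ℚ t * ℕ→ℚ t))
          * sumQ k (λ j → d zero j * d (suc zero) j)
      - ℕ→ℚ 2 * ε * ℕ→ℚ k * ℕ→ℚ t * ℕ→ℚ (eCount H (isA c zero) (isA c (suc zero)))
      ≤ ℕ→ℚ (triangleCount H (isA c zero) (isA c (suc zero)))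
lemma4 ε 0<ε k t n H c ∣A∣≡t ∣B∣≡t d 0≤d uniform dense = begin
  C * sumQ k f - ℕ→ℚ 2 * ε * ℕ→ℚ k * ℕ→ℚ t * e
    ≡⟨ cong₂ _-_ (cong (C *_) (sumQ-∑ k f)) (pull-k (ℕ→ℚ 2 * ε) (ℕ→ℚ k) (ℕ→ℚ t) e) ⟩
  C * ∑[ j < k ] f j - ℕ→ℚ k * K
    ≡⟨ ∑-affine k C K f ⟨
  ∑[ j < k ] (C * f j - K)
    ≤⟨ ∑-mono-≤ one-part ⟩
  ∑[ j < k ] ℕ→ℚ (trianglesAcross H A₁ A₂ (B j))
    ≡⟨ ℕ→ℚ-∑ (λ j → trianglesAcross H A₁ A₂ (B j)) ⟨
  ℕ→ℚ (ℕ∑.sum (λ j → trianglesAcross H A₁ A₂ (B j)))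
    ≡⟨ cong ℕ→ℚ (∑-trianglesAcross H A₁ A₂ B (inSomeB c) (∑-isB c)) ⟩
  ℕ→ℚ (trianglesAcross H A₁ A₂ (inSomeB c))
    ≤⟨ ℕ→ℚ-mono-≤ (trianglesAcross≤triangleCount H (labelling-part c)) ⟩
  ℕ→ℚ (triangleCount H A₁ A₂) ∎
  where
  open ℚ.≤-Reasoning
  A₁ A₂ : VSet n
  A₁ = isA c 0F
  A₂ = isA c 1F
  B : Fin k → VSet n
  B = isB c
  e C K : ℚ
  e = ℕ→ℚ (eCount H A₁ A₂)
  C = ℕ→ℚ t * (e - ℕ→ℚ 2 * ε * (ℕ→ℚ t * ℕ→ℚ t))
  K = ℕ→ℚ 2 * ε * ℕ→ℚ t * e
  f : Fin k → ℚ
  f j = d 0F j * d 1F j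
  pull-k : ∀ a k t e → a * k * t * e ≡ k * (a * t * e)
  pull-k = solve-∀ ℚ-ring
  one-part : ∀ j → C * f j - K ≤ ℕ→ℚ (trianglesAcross H A₁ A₂ (B j))
  one-part j = trianglesAcross-≥ H ε 0<ε t A₁ A₂ (B j) (∣A∣≡t 0F) (∣A∣≡t 1F) (∣B∣≡t j) (uniform 0F j) (uniform 1F j)
                                 (d 0F j) (d 1F j) (0≤d 0F j) (0≤d 1F j) (dense 0F j) (dense 1F j)
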